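{- Let $G$ be a finite simple graph with edge set $E$ (with at least one edge), equipped with any orientation of its edges. Then $\mathcal{H}(G)$ is reducible if and only if there is a partition $E=E_1\cup E_2$ into two nonempty disjoint sets such that for every pair of edges $e_1\in E_1$ and $e_2\in E_2$, either $e_1$ and $e_2$ are two edges of a common triangle of $G$, or $e_1$ and $e_2$ share no endpoint.
   Context: For an oriented simple graph $G$ with edge set $E$, $|E|=m$, each edge $e$ has a head $e^+$ and a tail $e^-$. For distinct edges $e,e'$: write $e\leftrightarrow e'$ if $e^+=e'^-$ or $e'^+=e^-$; write $e\overset{\pm}{\sim}e'$ if $e^+=e'^+$ or $e^-=e'^-$; write $e\vartriangle e'$ if $e$ and $e'$ are two edges of a common triangle of $G$. Let $\triangle(e)$ be the number of triangles of $G$ containing $e$. The Helmholtzian matrix $\mathcal{H}(G)=(h_{ee'})$ is the $m\times m$ matrix indexed by $E$ with $h_{ee}=\triangle(e)+2$; for $e'\neq e$, $h_{ee'}=-1$ if $e\leftrightarrow e'$ and not $e\vartriangle e'$, $h_{ee'}=1$ if $e\overset{\pm}{\sim}e'$ and not $e\vartriangle e'$, and $h_{ee'}=0$ otherwise. A symmetric square matrix $M$ is reducible if there is a permutation matrix $P$ with $P^{ -1}MP=\begin{pmatrix}E&O\\O&F\end{pmatrix}$ for some square matrices $E,F$ (of positive size); otherwise it is irreducible. -}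

module Defs where

open import Data.Nat using (ℕ; zero; suc; _+_; _<_; _≤_)
open import Data.Fin using (Fin; toℕ)
open import Data.Fin.Properties using (any?; _≟_)
open import Data.Fin.Permutation using (Permutation′; _⟨$⟩ʳ_)
open import Data.Bool using (Bool; true; false)
open import Data.Integer using (ℤ; +_; -[1+_])
open import Data.List using (List; length; filter)
open import Data.List.Base using (allFin)
open import Data.Product using (Σ; ∃; _×_; _,_)
open import Data.Sum using (_⊎_)
open import Relation.Nullary using (¬_; Dec; yes; no)
open import Relation.Nullary.Decidable using (_×-dec_; _⊎-dec_; ¬?)
open import Relation.Binary.PropositionalEquality using (_≡_; _≢_)

-- An oriented simple graph on vertex set Fin n with edge set Fin m.
-- Edge e goes from its tail (e⁻) to its head (e⁺).
record OrientedGraph (n m : ℕ) : Set where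
  field
    tail : Fin m → Fin n
    head : Fin m → Fin n
    noLoop : ∀ e → tail e ≢ head e
    simple : ∀ e e' →
      ((tail e ≡ tail e' × head e ≡ head e') ⊎ (tail e ≡ head e' × head e ≡ tail e')) →
      e ≡ e'

module _ {n m : ℕ} (G : OrientedGraph n m) where
  open OrientedGraph G

  EdgeOn : Fin m → Fin n → Fin n → Set
  EdgeOn e u v = (tail e ≡ u × head e ≡ v) ⊎ (tail e ≡ v × head e ≡ u)

  Adj : Fin n → Fin n → Set
  Adj u v = ∃ λ e → EdgeOn e u v

  Adj? : ∀ u v → Dec (Adj u v)
  Adj? u v = any? λ e → ((tail e ≟ u) ×-dec (head e ≟ v)) ⊎-dec ((tail e ≟ v) ×-dec (head e ≟ u))

  In3 : Fin n → Fin n → Fin n → Fin n → Set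
  In3 x a b c = x ≡ a ⊎ x ≡ b ⊎ x ≡ c

  IsTriangle : Fin n → Fin n → Fin n → Set
  IsTriangle a b c = Adj a b × Adj b c × Adj a c

  EdgeOfTri : Fin m → Fin n → Fin n → Fin n → Set
  EdgeOfTri e a b c = In3 (tail e) a b c × In3 (head e) a b c

  _△_ : Fin m → Fin m → Set
  e △ e' = e ≢ e' × (∃ λ a → ∃ λ b → ∃ λ c →
             IsTriangle a b c × EdgeOfTri e a b c × EdgeOfTri e' a b c)

  private
    In3? : ∀ x a b c → Dec (In3 x a b c)
    In3? x a b c = (x ≟ a) ⊎-dec ((x ≟ b) ⊎-dec (x ≟ c))

  △? : ∀ e e' → Dec (e △ e')
  △? e e' = ¬? (e ≟ e') ×-dec any? λ a → any? λ b → any? λ c →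
    (Adj? a b ×-dec (Adj? b c ×-dec Adj? a c)) ×-dec
    ((In3? (tail e) a b c ×-dec In3? (head e) a b c) ×-dec
     (In3? (tail e') a b c ×-dec In3? (head e') a b c))

  _⇄_ : Fin m → Fin m → Set
  e ⇄ e' = e ≢ e' × (head e ≡ tail e' ⊎ head e' ≡ tail e)

  ⇄? : ∀ e e' → Dec (e ⇄ e')
  ⇄? e e' = ¬? (e ≟ e') ×-dec ((head e ≟ tail e') ⊎-dec (head e' ≟ tail e))

  _±∼_ : Fin m → Fin m → Set
  e ±∼ e' = e ≢ e' × (head e ≡ head e' ⊎ tail e ≡ tail e')

  ±∼? : ∀ e e' → Dec (e ±∼ e')
  ±∼? e e' = ¬? (e ≟ e') ×-dec ((head e ≟ head e') ⊎-dec (tail e ≟ tail e'))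

  -- △(e): number of triangles containing e.  A triangle containing e is
  -- determined by its third vertex c, adjacent to both endpoints of e.
  triCount : Fin m → ℕ
  triCount e = length (filter (λ c → Adj? c (tail e) ×-dec Adj? c (head e)) (allFin n))

  helmholtzian : Fin m → Fin m → ℤ
  helmholtzian e e' with e ≟ e'
  ... | yes _ = + (triCount e + 2)
  ... | no _ with △? e e'
  ...   | yes _ = + 0
  ...   | no _ with ⇄? e e'
  ...     | yes _ = -[1+ 0 ]
  ...     | no _ with ±∼? e e'
  ...       | yes _ = + 1
  ...       | no _ = + 0

  ShareEndpoint : Fin m → Fin m → Set
  ShareEndpoint e e' = tail e ≡ tail e' ⊎ tail e ≡ head e' ⊎ head e ≡ tail e' ⊎ head e ≡ head e'

Reducible : {m : ℕ} → (Fin m → Fin m → ℤ) → Set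
Reducible {m} M = Σ ℕ λ a → Σ ℕ λ b → (1 ≤ a) × (1 ≤ b) × (a + b ≡ m) ×
  Σ (Permutation′ m) λ σ → ∀ (i j : Fin m) → toℕ i < a → a ≤ toℕ j →
    (M (σ ⟨$⟩ʳ i) (σ ⟨$⟩ʳ j) ≡ + 0) × (M (σ ⟨$⟩ʳ j) (σ ⟨$⟩ʳ i) ≡ + 0)

EdgePartitionProperty : {n m : ℕ} → OrientedGraph n m → Set
EdgePartitionProperty {n} {m} G = Σ (Fin m → Bool) λ inE₁ →
  (∃ λ e → inE₁ e ≡ true) × (∃ λ e → inE₁ e ≡ false) ×
  (∀ e₁ e₂ → inE₁ e₁ ≡ true → inE₁ e₂ ≡ false →
     _△_ G e₁ e₂ ⊎ ¬ ShareEndpoint G e₁ e₂)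

{-# OPTIONS --safe #-}
-- A Helmholtzian entry h_{ee'} vanishes exactly when e and e' lie in a common
-- triangle or share no endpoint: the diagonal entries are positive, and an
-- off-diagonal entry is ±1 precisely when the two edges share an endpoint
-- without spanning a triangle.  This condition is symmetric, so H(G) is
-- reducible iff E splits into two nonempty parts with the condition holding
-- across them; a split yields the block decomposition under a permutation
-- listing the first part before the second, found by selection sort.
module Submission where

open import Defs
open import Data.Bool using (Bool; true; false)
open import Data.Bool.Properties using (¬-not)
open import Data.Fin using (Fin; zero; suc; toℕ; fromℕ<)
open import Data.Fin.Permutation
  using (Permutation′; _⟨$⟩ʳ_; _⟨$⟩ˡ_; id; _∘ₚ_; lift₀; transpose; inverseˡ; inverseʳ)
open import Data.Fin.Properties using (_≟_; any?; toℕ<n; toℕ-fromℕ<)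
open import Data.Integer using (ℤ; +_)
open import Data.Integer.Properties using (+-injective)
open import Data.Nat using (ℕ; _+_; _∸_; _<_; _≤_; z≤n; z<s; s≤s; _<?_)
open import Data.Nat.Properties
  using (≤⇒≯; ≮⇒≥; <⇒≤; ≤-<-trans; ≤-reflexive; m<m+n; m<n⇒0<n∸m; m+[n∸m]≡n; m+n≡0⇒n≡0)
open import Data.Product using (Σ; ∃; ∃₂; _×_; _,_; proj₁)
open import Data.Sum using (_⊎_; inj₁; inj₂; [_,_]′)
open import Function using (_∘_; _∘₂_)
open import Function.Bundles using (_⇔_; mk⇔; Equivalence)
open import Function.Construct.Composition using (_⇔-∘_)
open import Relation.Nullary using (¬_; Dec; yes; no; does; contradiction)
open import Relation.Nullary.Decidable using (dec-true; dec-false)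
open import Relation.Binary.PropositionalEquality
  using (_≡_; _≢_; refl; sym; trans; cong; subst₂)
import Data.Bool.Properties as Bool

private
  variable
    m : ℕ

dec-true⁻¹ : ∀ {A : Set} (a? : Dec A) → does a? ≡ true → A
dec-true⁻¹ (yes a) _ = a

dec-false⁻¹ : ∀ {A : Set} (a? : Dec A) → does a? ≡ false → ¬ A
dec-false⁻¹ (no ¬a) _ = ¬a

TruesFirst : (Fin m → Bool) → ℕ → Permutation′ m → Set
TruesFirst p a σ = ∀ k → p (σ ⟨$⟩ʳ k) ≡ does (toℕ k <? a)

module TruesFirstProperties {p : Fin m → Bool} {a : ℕ} {σ : Permutation′ m} (t : TruesFirst p a σ) where

  true⇔< : ∀ k → p (σ ⟨$⟩ʳ k) ≡ true ⇔ toℕ k < a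
  true⇔< k = mk⇔
    (λ pk → dec-true⁻¹ (toℕ k <? a) (trans (sym (t k)) pk))
    (λ k<a → trans (t k) (dec-true (toℕ k <? a) k<a))

  false⇔≥ : ∀ k → p (σ ⟨$⟩ʳ k) ≡ false ⇔ a ≤ toℕ k
  false⇔≥ k = mk⇔
    (λ pk → ≮⇒≥ (dec-false⁻¹ (toℕ k <? a) (trans (sym (t k)) pk)))
    (λ a≤k → trans (t k) (dec-false (toℕ k <? a) (≤⇒≯ a≤k)))

sort-truesFirst : (p : Fin m → Bool) → ∃₂ λ a σ → TruesFirst p a σ
sort-truesFirst {ℕ.zero} p = 0 , id , λ ()
sort-truesFirst {ℕ.suc m} p with any? (λ i → p i Bool.≟ true)
... | no none = 0 , id , λ k → ¬-not (none ∘ (k ,_))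
... | yes (i , pᵢ) with sort-truesFirst (λ k → p (transpose zero i ⟨$⟩ʳ suc k))
...   | a , σ , t = ℕ.suc a , lift₀ σ ∘ₚ transpose zero i , λ where
  zero → pᵢ
  (suc k) → t k

Splits : (Fin m → Fin m → Set) → Set
Splits {m} R = Σ (Fin m → Bool) λ p →
  (∃ λ i → p i ≡ true) × (∃ λ i → p i ≡ false) ×
  (∀ i j → p i ≡ true → p j ≡ false → R i j)

Splits-cong : {R S : Fin m → Fin m → Set} → (∀ i j → R i j ⇔ S i j) → Splits R ⇔ Splits S
Splits-cong R⇔S = mk⇔ (transport (Equivalence.to ∘₂ R⇔S)) (transport (Equivalence.from ∘₂ R⇔S))
  where
  transport : ∀ {R S} → (∀ i j → R i j → S i j) → Splits R → Splits S
  transport R⇒S (p , tr , fa , across) = p , tr , fa , λ i j pᵢ pⱼ → R⇒S i j (across i j pᵢ pⱼ)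

Decoupled : (Fin m → Fin m → ℤ) → Fin m → Fin m → Set
Decoupled M i j = M i j ≡ + 0 × M j i ≡ + 0

module _ {M : Fin m → Fin m → ℤ} where

  reducible⇒splits : Reducible M → Splits (Decoupled M)
  reducible⇒splits (a , b , s≤s z≤n , 1≤b , refl , σ , blocks) =
    p , (σ ⟨$⟩ʳ zero , true⇔< zero .from z<s) ,
    (σ ⟨$⟩ʳ first₂ , false⇔≥ first₂ .from (≤-reflexive (sym (toℕ-fromℕ< a<a+b)))) ,
    decoupled
    where
    p : Fin (a + b) → Bool
    p e = does (toℕ (σ ⟨$⟩ˡ e) <? a)
    t : TruesFirst p a σ
    t k = cong (λ k′ → does (toℕ k′ <? a)) (inverseˡ σ)
    open Equivalence
    open TruesFirstProperties {p = p} {a = a} {σ = σ} t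
    a<a+b : a < a + b
    a<a+b = m<m+n a 1≤b
    first₂ : Fin (a + b)
    first₂ = fromℕ< a<a+b
    decoupled : ∀ e₁ e₂ → p e₁ ≡ true → p e₂ ≡ false → Decoupled M e₁ e₂
    decoupled e₁ e₂ p₁ p₂ = subst₂ (Decoupled M) (inverseʳ σ) (inverseʳ σ)
      (blocks (σ ⟨$⟩ˡ e₁) (σ ⟨$⟩ˡ e₂)
        (dec-true⁻¹ (_ <? a) p₁) (≮⇒≥ (dec-false⁻¹ (_ <? a) p₂)))

  splits⇒reducible : Splits (Decoupled M) → Reducible M
  splits⇒reducible (p , (e₁ , p₁) , (e₂ , p₂) , decoupled) with sort-truesFirst p
  ... | a , σ , t = a , m ∸ a , 0<a , m<n⇒0<n∸m a<m , m+[n∸m]≡n (<⇒≤ a<m) , σ , blocks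
    where
    open Equivalence
    open TruesFirstProperties {p = p} {a = a} {σ = σ} t
    0<a : 0 < a
    0<a = ≤-<-trans z≤n (true⇔< _ .to (trans (cong p (inverseʳ σ)) p₁))
    a<m : a < m
    a<m = ≤-<-trans (false⇔≥ _ .to (trans (cong p (inverseʳ σ)) p₂)) (toℕ<n (σ ⟨$⟩ˡ e₂))
    blocks : ∀ i j → toℕ i < a → a ≤ toℕ j → Decoupled M (σ ⟨$⟩ʳ i) (σ ⟨$⟩ʳ j)
    blocks i j i<a a≤j = decoupled _ _ (true⇔< i .from i<a) (false⇔≥ j .from a≤j)

  reducible⇔splits : Reducible M ⇔ Splits (Decoupled M)
  reducible⇔splits = mk⇔ reducible⇒splits splits⇒reducible

module _ {n m : ℕ} (G : OrientedGraph n m) where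

  Separated : Fin m → Fin m → Set
  Separated e e′ = _△_ G e e′ ⊎ ¬ ShareEndpoint G e e′

  △-sym : ∀ {e e′} → _△_ G e e′ → _△_ G e′ e
  △-sym (e≢e′ , a , b , c , tri , e∈abc , e′∈abc) = e≢e′ ∘ sym , a , b , c , tri , e′∈abc , e∈abc

  shareEndpoint-sym : ∀ {e e′} → ShareEndpoint G e e′ → ShareEndpoint G e′ e
  shareEndpoint-sym (inj₁ t≡t) = inj₁ (sym t≡t)
  shareEndpoint-sym (inj₂ (inj₁ t≡h)) = inj₂ (inj₂ (inj₁ (sym t≡h)))
  shareEndpoint-sym (inj₂ (inj₂ (inj₁ h≡t))) = inj₂ (inj₁ (sym h≡t))
  shareEndpoint-sym (inj₂ (inj₂ (inj₂ h≡h))) = inj₂ (inj₂ (inj₂ (sym h≡h)))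

  separated-sym : ∀ {e e′} → Separated e e′ → Separated e′ e
  separated-sym (inj₁ tri) = inj₁ (△-sym tri)
  separated-sym (inj₂ disjoint) = inj₂ (disjoint ∘ shareEndpoint-sym)

  ⇄⇒shareEndpoint : ∀ {e e′} → _⇄_ G e e′ → ShareEndpoint G e e′
  ⇄⇒shareEndpoint (_ , inj₁ h≡t) = inj₂ (inj₂ (inj₁ h≡t))
  ⇄⇒shareEndpoint (_ , inj₂ h′≡t) = inj₂ (inj₁ (sym h′≡t))

  ±∼⇒shareEndpoint : ∀ {e e′} → _±∼_ G e e′ → ShareEndpoint G e e′
  ±∼⇒shareEndpoint (_ , inj₁ h≡h) = inj₂ (inj₂ (inj₂ h≡h))
  ±∼⇒shareEndpoint (_ , inj₂ t≡t) = inj₁ t≡t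

  shareEndpoint⇒⇄⊎±∼ : ∀ {e e′} → e ≢ e′ → ShareEndpoint G e e′ → _⇄_ G e e′ ⊎ _±∼_ G e e′
  shareEndpoint⇒⇄⊎±∼ e≢e′ (inj₁ t≡t) = inj₂ (e≢e′ , inj₂ t≡t)
  shareEndpoint⇒⇄⊎±∼ e≢e′ (inj₂ (inj₁ t≡h)) = inj₁ (e≢e′ , inj₂ (sym t≡h))
  shareEndpoint⇒⇄⊎±∼ e≢e′ (inj₂ (inj₂ (inj₁ h≡t))) = inj₁ (e≢e′ , inj₁ h≡t)
  shareEndpoint⇒⇄⊎±∼ e≢e′ (inj₂ (inj₂ (inj₂ h≡h))) = inj₂ (e≢e′ , inj₁ h≡h)

  helmholtzian≡0⇒separated : ∀ e e′ → helmholtzian G e e′ ≡ + 0 → Separated e e′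
  helmholtzian≡0⇒separated e e′ h with e ≟ e′
  ... | yes _ with () ← m+n≡0⇒n≡0 (triCount G e) (+-injective h)
  ... | no e≢e′ with △? G e e′
  ...   | yes tri = inj₁ tri
  ...   | no _ with ⇄? G e e′
  ...     | yes _ with () ← h
  ...     | no ¬⇄ with ±∼? G e e′
  ...       | yes _ with () ← h
  ...       | no ¬±∼ = inj₂ ([ ¬⇄ , ¬±∼ ]′ ∘ shareEndpoint⇒⇄⊎±∼ e≢e′)

  △⇒helmholtzian≡0 : ∀ e e′ → _△_ G e e′ → helmholtzian G e e′ ≡ + 0
  △⇒helmholtzian≡0 e e′ tri with e ≟ e′
  ... | yes e≡e′ = contradiction e≡e′ (proj₁ tri)
  ... | no _ with △? G e e′
  ...   | yes _ = refl
  ...   | no ¬tri = contradiction tri ¬tri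

  disjoint⇒helmholtzian≡0 : ∀ e e′ → ¬ ShareEndpoint G e e′ → helmholtzian G e e′ ≡ + 0
  disjoint⇒helmholtzian≡0 e e′ disjoint with e ≟ e′
  ... | yes refl = contradiction (inj₁ refl) disjoint
  ... | no _ with △? G e e′
  ...   | yes _ = refl
  ...   | no _ with ⇄? G e e′
  ...     | yes e⇄e′ = contradiction (⇄⇒shareEndpoint e⇄e′) disjoint
  ...     | no _ with ±∼? G e e′
  ...       | yes e±∼e′ = contradiction (±∼⇒shareEndpoint e±∼e′) disjoint
  ...       | no _ = refl

  separated⇒helmholtzian≡0 : ∀ e e′ → Separated e e′ → helmholtzian G e e′ ≡ + 0
  separated⇒helmholtzian≡0 e e′ = [ △⇒helmholtzian≡0 e e′ , disjoint⇒helmholtzian≡0 e e′ ]′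

  decoupled⇔separated : ∀ e e′ → Decoupled (helmholtzian G) e e′ ⇔ Separated e e′
  decoupled⇔separated e e′ = mk⇔
    (helmholtzian≡0⇒separated e e′ ∘ proj₁)
    (λ s → separated⇒helmholtzian≡0 e e′ s , separated⇒helmholtzian≡0 e′ e (separated-sym s))

-- EdgePartitionProperty G unfolds to Splits (Separated G).
proposition3p1 : (n m : ℕ) → 1 ≤ m → (G : OrientedGraph n m) →
    Reducible (helmholtzian G) ⇔ EdgePartitionProperty G
proposition3p1 n m _ G = Splits-cong (decoupled⇔separated G) ⇔-∘ reducible⇔splits
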